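{- For all $n\in\mathbb{N}$, $\pi\in S_n'$ and $1\le i\le\operatorname{sc}(\pi)$, the sequence $\big(\operatorname{row}_\pi(c_{\pi,i,j})\big)_{j=1}^{|C_{\pi,i}|}$ is strictly increasing.
   Context: A "permutation" may be any finite sequence of distinct integers. West's stack-sorting map $s$: read the input left to right with an initially empty stack; repeatedly, if the input is nonempty and either the stack is empty or the top of the stack is greater than the next input entry, push the next entry; otherwise pop the top of the stack and append it to the output; stop when input and stack are empty. $\operatorname{sc}(\pi)$ is the least $k\ge0$ with $s^k(\pi)$ increasing. $S_n'$ is the set of permutations of $\{0,1,\dots,n\}$ whose last entry is $0$. For $\pi\in S_n'$ and $1\le i\le\operatorname{sc}(\pi)$ let $\sigma=s^{i-1}(\pi)$. Let $c_{\pi,i,1}$ be the maximum of the entries of $\sigma$ strictly left of $0$; for $j\ge2$, as long as some entry of $\sigma$ lies strictly between $c_{\pi,i,j-1}$ and $0$, let $c_{\pi,i,j}$ be the maximum of those entries; otherwise stop. This gives $C_{\pi,i}=(c_{\pi,i,1},\dots,c_{\pi,i,|C_{\pi,i}|})$. Blocks: $b_{\pi,i,1}$ is the contiguous subsequence of $\sigma$ strictly before $c_{\pi,i,1}$, and $b_{\pi,i,j}$ ($j\ge2$) the contiguous subsequence strictly between $c_{\pi,i,j-1}$ and $c_{\pi,i,j}$. Every $x\in[n]$ equals $c_{\pi,i,j}$ for a unique pair $(i,j)$; set $\operatorname{col}_\pi(x)=i$, $\operatorname{colpos}_\pi(x)=j$. If $\operatorname{col}_\pi(x)>1$, there is a unique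 $j$ with $x=\max(b_{\pi,\operatorname{col}_\pi(x)-1,j})$, and one sets $\operatorname{leftof}_\pi(x)=c_{\pi,\operatorname{col}_\pi(x)-1,j}$. Define recursively $\operatorname{row}_\pi(x)=\operatorname{colpos}_\pi(x)$ if $\operatorname{col}_\pi(x)=1$ and $\operatorname{row}_\pi(x)=\operatorname{row}_\pi(\operatorname{leftof}_\pi(x))$ if $\operatorname{col}_\pi(x)>1$ (well defined since $\operatorname{col}_\pi(\operatorname{leftof}_\pi(x))=\operatorname{col}_\pi(x)-1$). -}

module Defs where

open import Data.Nat using (ℕ; zero; suc; _+_; _∸_; _<_; _≤_; _⊔_; _<ᵇ_; _≡ᵇ_)
open import Data.Bool using (Bool; true; false; if_then_else_)
open import Data.List using (List; []; _∷_; _++_; length; map)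
open import Data.List.Relation.Unary.Linked using (Linked)
open import Data.Maybe using (Maybe; just; nothing; _>>=_)
open import Data.Product using (_×_; _,_; proj₁; proj₂; Σ)
open import Relation.Binary.PropositionalEquality using (_≡_)
open import Relation.Nullary using (¬_)
open import Function using (_∘_)

-- West's stack-sorting map, literally as a stack machine.
-- run input stack : output.

run : List ℕ → List ℕ → List ℕ
run []       []       = []
run []       (t ∷ st) = t ∷ run [] st
run (x ∷ xs) []       = run xs (x ∷ [])
run (x ∷ xs) (t ∷ st) = if x <ᵇ t then run xs (x ∷ t ∷ st) else t ∷ run (x ∷ xs) st

s : List ℕ → List ℕ
s π = run π []

iter : ℕ → List ℕ → List ℕ
iter zero    π = π
iter (suc k) π = iter k (s π)

Increasing : List ℕ → Set
Increasing = Linked _<_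

IsSc : List ℕ → ℕ → Set
IsSc π k = Increasing (iter k π) × (∀ j → j < k → ¬ Increasing (iter j π))

-- S_n' : permutations of {0,1,…,n} whose last entry is 0
-- (a list is a permutation of {0,…,n} iff it is ↭ to upTo (suc n)).

maxL : List ℕ → Maybe ℕ
maxL []       = nothing
maxL (x ∷ xs) with maxL xs
... | nothing = just x
... | just m  = just (x ⊔ m)

splitAt= : ℕ → List ℕ → List ℕ × List ℕ
splitAt= y []       = [] , []
splitAt= y (x ∷ xs) = if x ≡ᵇ y then ([] , xs)
                      else (x ∷ proj₁ (splitAt= y xs) , proj₂ (splitAt= y xs))

leftOf0 : List ℕ → List ℕ
leftOf0 σ = proj₁ (splitAt= 0 σ)

-- 1-indexed position of y in a list
indexOf : ℕ → List ℕ → Maybe ℕ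
indexOf y []       = nothing
indexOf y (x ∷ xs) = if x ≡ᵇ y then just 1 else (indexOf y xs >>= λ k → just (suc k))

-- 1-indexed lookup
nth : ℕ → List ℕ → Maybe ℕ
nth _             []       = nothing
nth zero          (x ∷ xs) = nothing
nth (suc zero)    (x ∷ xs) = just x
nth (suc (suc k)) (x ∷ xs) = nth (suc k) xs

-- The first argument is fuel (length L suffices, since
-- each step removes at least one entry).

chainBlocks : ℕ → List ℕ → List (List ℕ × ℕ)
chainBlocks zero     L = []
chainBlocks (suc f) L with maxL L
... | nothing = []
... | just c  = (proj₁ (splitAt= c L) , c) ∷ chainBlocks f (proj₂ (splitAt= c L))

CB : List ℕ → ℕ → List (List ℕ × ℕ)
CB π i = chainBlocks (length σ) (leftOf0 σ)
  where σ = iter (i ∸ 1) π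

C : List ℕ → ℕ → List ℕ
C π i = map proj₂ (CB π i)

B : List ℕ → ℕ → List (List ℕ)
B π i = map proj₁ (CB π i)

colSearch : List ℕ → ℕ → ℕ → ℕ → Maybe ℕ
colSearch π x start zero    = nothing
colSearch π x start (suc f) with indexOf x (C π start)
... | just _  = just start
... | nothing = colSearch π x (suc start) f

-- col_π(x): the i with x = c_{π,i,j}; searched among 1 ≤ i ≤ length π
-- (this range contains 1 … sc(π), since sc(π) ≤ n).
col : List ℕ → ℕ → Maybe ℕ
col π x = colSearch π x 1 (length π)

colpos : List ℕ → ℕ → Maybe ℕ
colpos π x = col π x >>= λ i → indexOf x (C π i)

blockWithMax : ℕ → List (List ℕ × ℕ) → Maybe ℕ
blockWithMax x []             = nothing
blockWithMax x ((b , c) ∷ bs) with maxL b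
... | just m  = if m ≡ᵇ x then just 1 else (blockWithMax x bs >>= λ k → just (suc k))
... | nothing = blockWithMax x bs >>= λ k → just (suc k)

leftof : List ℕ → ℕ → Maybe ℕ
leftof π x = col π x >>= λ i → blockWithMax x (CB π (i ∸ 1)) >>= λ j → nth j (C π (i ∸ 1))

-- row_π, by the recursion of the paper; fuel bounds the number of
-- recursive steps (col decreases by one each step, so length π suffices)
rowF : List ℕ → ℕ → ℕ → Maybe ℕ
rowF π zero    x = nothing
rowF π (suc f) x = col π x >>= λ i →
  if i ≡ᵇ 1 then colpos π x else (leftof π x >>= rowF π f)

row : List ℕ → ℕ → Maybe ℕ
row π x = rowF π (length π) x

StrictlyIncreasingDefined : List (Maybe ℕ) → Set
StrictlyIncreasingDefined ms = Σ (List ℕ) λ rs → (ms ≡ map just rs) × Linked _<_ rs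

{-# OPTIONS --safe #-}
-- Let σ = s^(i-1)(π) = L 0 R. The chain C_{π,i} is the sequence c₁ > c₂ > … of right-to-left
-- maxima of L, which cuts L as b₁ c₁ b₂ c₂ …. Since c_j exceeds everything after it in L, the
-- stack machine outputs s(b_j) completely before pushing c_j, and the c_j stay on the stack until
-- 0 has passed; so the part of s(σ) left of 0 is s(b₁) s(b₂) …. As s(b) ends with max b, the
-- right-to-left maxima of that word, i.e. C_{π,i+1}, form a subsequence of the block maxima
-- max b_j, and leftof sends max b_j to c_j. Hence the rows of C_{π,i+1} are a subsequence of the
-- rows of C_{π,i}, and the induction starts from the rows 1, 2, … of C_{π,1}. The columns are
-- disjoint and each step strictly shortens the part left of 0, which is what makes col (and so
-- row) find the intended column within its bounded search.
module Submission where

open import Defs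
open import Data.Bool using (true; false; T; if_then_else_)
open import Data.Bool.Properties using (T-≡; if-cong; if-cong₂; if-float)
open import Data.Empty using (⊥-elim)
open import Data.List using (List; []; _∷_; _++_; [_]; concat; length; map; upTo; applyUpTo)
open import Data.List.Properties using (++-assoc; length-++; map-∘; map-cong-local)
open import Data.List.Membership.Propositional using (_∈_; _∉_)
open import Data.List.Membership.Propositional.Properties using (∈-++⁺ˡ; ∈-++⁺ʳ)
open import Data.List.Relation.Binary.Permutation.Propositional
  using (_↭_; ↭-refl; ↭-sym; ↭-trans; prep; ↭⇒↭ₛ; module PermutationReasoning)
import Data.List.Relation.Binary.Permutation.Propositional.Properties as ↭
import Data.List.Relation.Binary.Permutation.Setoid.Properties as PermutationSetoid
open import Data.List.Relation.Binary.Sublist.Heterogeneous using (Sublist; []; _∷_; _∷ʳ_)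
open import Data.List.Relation.Binary.Sublist.Propositional using (_⊆_; ⊆-refl)
import Data.List.Relation.Binary.Sublist.Propositional.Properties as ⊆
open import Data.List.Relation.Unary.All as All using (All; []; _∷_)
import Data.List.Relation.Unary.All.Properties as Allₚ
open import Data.List.Relation.Unary.AllPairs as AllPairs using (AllPairs; []; _∷_)
import Data.List.Relation.Unary.AllPairs.Properties as AllPairsₚ
open import Data.List.Relation.Unary.Any using (here; there)
open import Data.List.Relation.Unary.Linked using (Linked; [])
open import Data.List.Relation.Unary.Linked.Properties using (Linked⇒AllPairs; AllPairs⇒Linked)
open import Data.List.Relation.Unary.Unique.Propositional using (Unique)
open import Data.List.Relation.Unary.Unique.Propositional.Properties using (upTo⁺)
open import Data.Maybe using (Maybe; just; nothing; _>>=_)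
open import Data.Nat using (ℕ; zero; suc; _+_; _∸_; _≤_; _<_; _<ᵇ_; _≡ᵇ_; s≤s; z<s; s<s)
open import Data.Nat.Properties
open import Data.Product using (Σ; ∃; _×_; _,_; proj₁; proj₂)
open import Data.Sum using (inj₁; inj₂)
open import Data.Unit using (⊤; tt)
open import Function using (_∘_; _$_; Equivalence)
open import Level using (Level)
open import Relation.Binary.Core using (Rel)
open import Relation.Binary.PropositionalEquality
  using (_≡_; _≢_; refl; sym; trans; cong; subst; subst₂; setoid; module ≡-Reasoning)
open import Relation.Nullary using (contradiction)

private
  variable
    a r : Level
    A : Set a
    xs ys : List A

<ᵇ-true : ∀ {m n} → m < n → (m <ᵇ n) ≡ true
<ᵇ-true = Equivalence.to T-≡ ∘ <⇒<ᵇ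

<ᵇ-false : ∀ {m n} → n ≤ m → (m <ᵇ n) ≡ false
<ᵇ-false {m} {n} n≤m with m <ᵇ n in eq
... | false = refl
... | true  = contradiction (<ᵇ⇒< m n (Equivalence.from T-≡ eq)) (≤⇒≯ n≤m)

≡ᵇ-refl : ∀ m → (m ≡ᵇ m) ≡ true
≡ᵇ-refl m = Equivalence.to T-≡ (≡⇒≡ᵇ m m refl)

≡ᵇ-false : ∀ {m n} → m ≢ n → (m ≡ᵇ n) ≡ false
≡ᵇ-false {m} {n} m≢n with m ≡ᵇ n in eq
... | false = refl
... | true  = contradiction (≡ᵇ⇒≡ m n (Equivalence.from T-≡ eq)) m≢n

if-elim : ∀ {p} (P : A → Set p) b {u v} → P u → P v → P (if b then u else v)
if-elim P true  pu _  = pu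
if-elim P false _  pv = pv

map-applyUpTo : ∀ {b} {B : Set b} (g : A → B) f n → map g (applyUpTo f n) ≡ applyUpTo (g ∘ f) n
map-applyUpTo g f zero    = refl
map-applyUpTo g f (suc n) = cong (g (f 0) ∷_) (map-applyUpTo g (f ∘ suc) n)

AllPairs-resp-⊆ : {R : Rel A r} → xs ⊆ ys → AllPairs R ys → AllPairs R xs
AllPairs-resp-⊆ []         []         = []
AllPairs-resp-⊆ (y ∷ʳ τ)   (_ ∷ rys)  = AllPairs-resp-⊆ τ rys
AllPairs-resp-⊆ (refl ∷ τ) (ry ∷ rys) = ⊆.All-resp-⊆ τ ry ∷ AllPairs-resp-⊆ τ rys

Unique-resp-⊆ : xs ⊆ ys → Unique ys → Unique xs
Unique-resp-⊆ = AllPairs-resp-⊆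

Unique-resp-↭ : xs ↭ ys → Unique xs → Unique ys
Unique-resp-↭ p = PermutationSetoid.Unique-resp-↭ (setoid _) (↭⇒↭ₛ p)

Unique-++-disjoint : ∀ {x} (xs : List A) → Unique (xs ++ ys) → x ∈ xs → x ∉ ys
Unique-++-disjoint (_ ∷ xs) (x≢ ∷ _) (here refl) x∈ys = All.lookup (Allₚ.++⁻ʳ xs x≢) x∈ys refl
Unique-++-disjoint (_ ∷ xs) (_ ∷ u)  (there x∈xs) = Unique-++-disjoint xs u x∈xs

Unique-++-tail : ∀ (xs : List A) → Unique (xs ++ ys) → Unique ys
Unique-++-tail xs = Unique-resp-⊆ (⊆.++⁺ˡ xs ⊆-refl)

Unique-concat⁻ : ∀ (xss : List (List A)) → Unique (concat xss) → All Unique xss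
Unique-concat⁻ []         _ = []
Unique-concat⁻ (xs ∷ xss) u =
  Unique-resp-⊆ (⊆.++⁺ʳ (concat xss) ⊆-refl) u ∷ Unique-concat⁻ xss (Unique-++-tail xs u)

⊆-map-just : ∀ {ms} {rs : List A} → ms ⊆ map just rs → ∃ λ rs′ → ms ≡ map just rs′ × rs′ ⊆ rs
⊆-map-just {rs = []}     []         = [] , refl , []
⊆-map-just {rs = r ∷ rs} (_ ∷ʳ τ)   with ⊆-map-just τ
... | rs′ , refl , τ′ = rs′ , refl , r ∷ʳ τ′
⊆-map-just {rs = r ∷ rs} (refl ∷ τ) with ⊆-map-just τ
... | rs′ , refl , τ′ = r ∷ rs′ , refl , refl ∷ τ′

StrictlyIncreasingDefined-resp-⊆ : ∀ {ms ns} → ms ⊆ ns →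
  StrictlyIncreasingDefined ns → StrictlyIncreasingDefined ms
StrictlyIncreasingDefined-resp-⊆ τ (rs , refl , increasing) with ⊆-map-just τ
... | rs′ , ms≡ , τ′ =
  rs′ , ms≡ , AllPairs⇒Linked (AllPairs-resp-⊆ τ′ (Linked⇒AllPairs <-trans increasing))

run-↭ : ∀ xs st → run xs st ↭ st ++ xs
run-↭ []       []       = ↭-refl
run-↭ []       (t ∷ st) = prep t (run-↭ [] st)
run-↭ (x ∷ xs) []       = run-↭ xs [ x ]
run-↭ (x ∷ xs) (t ∷ st) = if-elim (_↭ t ∷ st ++ x ∷ xs) (x <ᵇ t)
  (↭-trans (run-↭ xs (x ∷ t ∷ st)) (↭-sym (↭.shift x (t ∷ st) xs)))
  (prep t (run-↭ (x ∷ xs) st))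

s-↭ : ∀ xs → s xs ↭ xs
s-↭ xs = run-↭ xs []

concat-map-s-↭ : ∀ (xss : List (List ℕ)) → concat (map s xss) ↭ concat xss
concat-map-s-↭ []         = ↭-refl
concat-map-s-↭ (xs ∷ xss) = ↭.++⁺ (s-↭ xs) (concat-map-s-↭ xss)

iter-suc : ∀ k π → iter (suc k) π ≡ s (iter k π)
iter-suc zero    π = refl
iter-suc (suc k) π = iter-suc k (s π)

iter-↭ : ∀ k π → iter k π ↭ π
iter-↭ zero    π = ↭-refl
iter-↭ (suc k) π = ↭-trans (iter-↭ k (s π)) (s-↭ π)

-- x <Top st: the stack machine would push x onto st.
_<Top_ : ℕ → List ℕ → Set
x <Top []      = ⊤
x <Top (t ∷ _) = x < t

run-[] : ∀ st → run [] st ≡ st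
run-[] []       = refl
run-[] (t ∷ st) = cong (t ∷_) (run-[] st)

run-bottom : ∀ xs sk st → All (_<Top st) xs → All (_<Top st) sk → run xs (sk ++ st) ≡ run xs sk ++ st
run-bottom []       []       st _ _ = run-[] st
run-bottom []       (t ∷ sk) st _ (_ ∷ sk<) = cong (t ∷_) (run-bottom [] sk st [] sk<)
run-bottom (x ∷ xs) []       []       (_ ∷ xs<) _ = run-bottom xs [ x ] [] xs< (tt ∷ [])
run-bottom (x ∷ xs) []       (t ∷ st) (x<t ∷ xs<) _ =
  trans (if-cong (<ᵇ-true x<t)) (run-bottom xs [ x ] (t ∷ st) xs< (x<t ∷ []))
run-bottom (x ∷ xs) (t ∷ sk) st (x< ∷ xs<) (t< ∷ sk<) = trans
  (if-cong₂ (x <ᵇ t) (run-bottom xs (x ∷ t ∷ sk) st xs< (x< ∷ t< ∷ sk<))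
                     (cong (t ∷_) (run-bottom (x ∷ xs) sk st (x< ∷ xs<) sk<)))
  (sym (if-float (_++ st) (x <ᵇ t)))

run-flush : ∀ c rest b sk st → All (_< c) b → All (_< c) sk → c <Top st →
            run (b ++ c ∷ rest) (sk ++ st) ≡ run b sk ++ run rest (c ∷ st)
run-flush c rest []      []       []       _ _ _ = refl
run-flush c rest []      []       (t ∷ st) _ _ c<t = if-cong (<ᵇ-true c<t)
run-flush c rest []      (t ∷ sk) st _ (t<c ∷ sk<c) c<st = trans (if-cong (<ᵇ-false (<⇒≤ t<c)))
  (cong (t ∷_) (run-flush c rest [] sk st [] sk<c c<st))
run-flush c rest (x ∷ b) []       []       (x<c ∷ b<c) _ _ =
  run-flush c rest b [ x ] [] b<c (x<c ∷ []) tt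
run-flush c rest (x ∷ b) []       (t ∷ st) (x<c ∷ b<c) _ c<t = trans (if-cong (<ᵇ-true (<-trans x<c c<t)))
  (run-flush c rest b [ x ] (t ∷ st) b<c (x<c ∷ []) c<t)
run-flush c rest (x ∷ b) (t ∷ sk) st (x<c ∷ b<c) (t<c ∷ sk<c) c<st = trans
  (if-cong₂ (x <ᵇ t) (run-flush c rest b (x ∷ t ∷ sk) st b<c (x<c ∷ t<c ∷ sk<c) c<st)
                     (cong (t ∷_) (run-flush c rest (x ∷ b) sk st (x<c ∷ b<c) sk<c c<st)))
  (sym (if-float (_++ run rest (c ∷ st)) (x <ᵇ t)))

maxL-nothing : ∀ xs → maxL xs ≡ nothing → xs ≡ []
maxL-nothing []       _ = refl
maxL-nothing (x ∷ xs) e with maxL xs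
maxL-nothing (x ∷ xs) () | nothing
maxL-nothing (x ∷ xs) () | just _

maxL-∈ : ∀ xs {m} → maxL xs ≡ just m → m ∈ xs
maxL-∈ (x ∷ xs) e with maxL xs in e′
maxL-∈ (x ∷ xs) refl | nothing = here refl
maxL-∈ (x ∷ xs) refl | just m with ⊔-sel x m
... | inj₁ x⊔m≡x = here x⊔m≡x
... | inj₂ x⊔m≡m = there (subst (_∈ xs) (sym x⊔m≡m) (maxL-∈ xs e′))

maxL-≤ : ∀ xs {m} → maxL xs ≡ just m → All (_≤ m) xs
maxL-≤ (x ∷ xs) e with maxL xs in e′
maxL-≤ (x ∷ xs) refl | nothing rewrite maxL-nothing xs e′ = ≤-refl ∷ []
maxL-≤ (x ∷ xs) refl | just m =
  m≤m⊔n x m ∷ All.map (λ y≤m → ≤-trans y≤m (m≤n⊔m x m)) (maxL-≤ xs e′)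

splitAt=-≡ : ∀ y xs → y ∈ xs → xs ≡ proj₁ (splitAt= y xs) ++ y ∷ proj₂ (splitAt= y xs)
splitAt=-≡ y (x ∷ xs) y∈ with x ≡ᵇ y in e
... | true = cong (_∷ xs) (≡ᵇ⇒≡ x y (Equivalence.from T-≡ e))
splitAt=-≡ y (x ∷ xs) (here refl)  | false = ⊥-elim (subst T e (≡⇒≡ᵇ x x refl))
splitAt=-≡ y (x ∷ xs) (there y∈xs) | false = cong (x ∷_) (splitAt=-≡ y xs y∈xs)

splitAt=-before-≢ : ∀ y xs → All (_≢ y) (proj₁ (splitAt= y xs))
splitAt=-before-≢ y []       = []
splitAt=-before-≢ y (x ∷ xs) with x ≡ᵇ y in e
... | true  = []
... | false = (λ x≡y → subst T e (≡⇒≡ᵇ x y x≡y)) ∷ splitAt=-before-≢ y xs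

splitAt-max : ∀ L {c} → Unique L → maxL L ≡ just c →
  let b = proj₁ (splitAt= c L); L′ = proj₂ (splitAt= c L) in
  L ≡ b ++ c ∷ L′ × All (_< c) b × All (_< c) L′
splitAt-max L {c} uL e = L≡ , b<c , L′<c
  where
  b  = proj₁ (splitAt= c L)
  L′ = proj₂ (splitAt= c L)
  L≡ : L ≡ b ++ c ∷ L′
  L≡ = splitAt=-≡ c L (maxL-∈ L e)
  ≤c : All (_≤ c) (b ++ c ∷ L′)
  ≤c = subst (All (_≤ c)) L≡ (maxL-≤ L e)
  c≢L′ : All (c ≢_) L′
  c≢L′ = AllPairs.head (Unique-resp-⊆ (⊆.++⁺ˡ b ⊆-refl) (subst Unique L≡ uL))
  b<c : All (_< c) b
  b<c = All.zipWith (λ (x≤c , x≢c) → ≤∧≢⇒< x≤c x≢c) (Allₚ.++⁻ˡ b ≤c , splitAt=-before-≢ c L)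
  L′<c : All (_< c) L′
  L′<c = All.zipWith (λ (x≤c , c≢x) → ≤∧≢⇒< x≤c (c≢x ∘ sym))
                     (All.tail (Allₚ.++⁻ʳ b ≤c) , c≢L′)

leftOf0-positive : ∀ σ → All (0 <_) (leftOf0 σ)
leftOf0-positive σ = All.map n≢0⇒n>0 (splitAt=-before-≢ 0 σ)

leftOf0-++ : ∀ xs ys → All (0 <_) xs → leftOf0 (xs ++ ys) ≡ xs ++ leftOf0 ys
leftOf0-++ []           ys []         = refl
leftOf0-++ (suc x ∷ xs) ys (_ ∷ xs>0) = cong (suc x ∷_) (leftOf0-++ xs ys xs>0)

leftOf0-run-0 : ∀ xs st → leftOf0 (run xs (0 ∷ st)) ≡ []
leftOf0-run-0 []      st = refl
leftOf0-run-0 (_ ∷ _) st = refl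

leftOf0-≡ : ∀ {σ} → 0 ∈ σ → σ ≡ leftOf0 σ ++ 0 ∷ proj₂ (splitAt= 0 σ)
leftOf0-≡ = splitAt=-≡ 0 _

leftOf0-⊆ : ∀ {σ} → 0 ∈ σ → leftOf0 σ ⊆ σ
leftOf0-⊆ {σ} 0∈σ = subst (leftOf0 σ ⊆_) (sym (leftOf0-≡ 0∈σ)) (⊆.++⁺ʳ _ ⊆-refl)

leftOf0-shorter : ∀ {σ} → 0 ∈ σ → length (leftOf0 σ) < length σ
leftOf0-shorter {σ} 0∈σ = begin-strict
  length (leftOf0 σ)                  <⟨ m<m+n _ z<s ⟩
  length (leftOf0 σ) + length (0 ∷ R) ≡⟨ length-++ (leftOf0 σ) ⟨
  length (leftOf0 σ ++ 0 ∷ R)         ≡⟨ cong length (leftOf0-≡ 0∈σ) ⟨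
  length σ                            ∎
  where
  open ≤-Reasoning
  R = proj₂ (splitAt= 0 σ)

-- IsMaxChain L ((b₁ , c₁) ∷ (b₂ , c₂) ∷ …): L = b₁ c₁ b₂ c₂ … with each c_j larger than its
-- block b_j and than everything after it; for L left of 0 in s^(i-1)(π) these are the paper's
-- blocks b_{π,i,j} and chain entries c_{π,i,j}.
data IsMaxChain : List ℕ → List (List ℕ × ℕ) → Set where
  []   : IsMaxChain [] []
  cons : ∀ {b c L ps} → All (_< c) b → All (_< c) L → IsMaxChain L ps →
         IsMaxChain (b ++ c ∷ L) ((b , c) ∷ ps)

chainBlocks-isMaxChain : ∀ f L → length L ≤ f → Unique L → IsMaxChain L (chainBlocks f L)
chainBlocks-isMaxChain zero    []       _ _ = []
chainBlocks-isMaxChain (suc f) []       _ _ = []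
chainBlocks-isMaxChain (suc f) (x ∷ xs) |L|≤ uL with maxL (x ∷ xs) in e
... | nothing = contradiction (maxL-nothing (x ∷ xs) e) λ ()
... | just c  = subst (λ L → IsMaxChain L ((b , c) ∷ chainBlocks f L′)) (sym L≡)
                  (cons b<c L′<c (chainBlocks-isMaxChain f L′ |L′|≤ uL′))
  where
  L  = x ∷ xs
  b  = proj₁ (splitAt= c L)
  L′ = proj₂ (splitAt= c L)
  split : L ≡ b ++ c ∷ L′ × All (_< c) b × All (_< c) L′
  split = splitAt-max L uL e
  L≡ = proj₁ split
  b<c = proj₁ (proj₂ split)
  L′<c = proj₂ (proj₂ split)
  cL′⊆L : c ∷ L′ ⊆ L
  cL′⊆L = subst (c ∷ L′ ⊆_) (sym L≡) (⊆.++⁺ˡ b ⊆-refl)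
  uL′ : Unique L′
  uL′ = AllPairs.tail (Unique-resp-⊆ cL′⊆L uL)
  |L′|≤ : length L′ ≤ f
  |L′|≤ = ≤-pred (≤-trans (⊆.length-mono-≤ cL′⊆L) |L|≤)

blocks : List (List ℕ × ℕ) → List ℕ
blocks ps = concat (map proj₁ ps)

isMaxChain-↭ : ∀ {L ps} → IsMaxChain L ps → L ↭ blocks ps ++ map proj₂ ps
isMaxChain-↭ []                                = ↭-refl
isMaxChain-↭ (cons {b} {c} {L} {ps} _ _ chain) = begin
  b ++ c ∷ L                   ↭⟨ ↭.++⁺ˡ b (prep c (isMaxChain-↭ chain)) ⟩
  b ++ c ∷ (blocks ps ++ cs)   ↭⟨ ↭.++⁺ˡ b (↭-sym (↭.shift c (blocks ps) cs)) ⟩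
  b ++ (blocks ps ++ c ∷ cs)   ≡⟨ ++-assoc b (blocks ps) (c ∷ cs) ⟨
  (b ++ blocks ps) ++ c ∷ cs   ∎
  where
  open PermutationReasoning
  cs = map proj₂ ps

rightToLeftMaxima : List ℕ → List ℕ
rightToLeftMaxima []       = []
rightToLeftMaxima (x ∷ xs) with maxL xs
... | nothing = x ∷ rightToLeftMaxima xs
... | just m  = if m <ᵇ x then x ∷ rightToLeftMaxima xs else rightToLeftMaxima xs

rightToLeftMaxima-++-dominated : ∀ xs ys {z} → All (_≤ z) xs → z ∈ ys →
  rightToLeftMaxima (xs ++ ys) ≡ rightToLeftMaxima ys
rightToLeftMaxima-++-dominated []       ys _            _   = refl
rightToLeftMaxima-++-dominated (x ∷ xs) ys (x≤z ∷ xs≤z) z∈ys with maxL (xs ++ ys) in e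
... | nothing = contradiction (subst (_ ∈_) (maxL-nothing (xs ++ ys) e) (∈-++⁺ʳ xs z∈ys)) λ ()
... | just m = trans (if-cong (<ᵇ-false x≤m)) (rightToLeftMaxima-++-dominated xs ys xs≤z z∈ys)
  where x≤m = ≤-trans x≤z (All.lookup (maxL-≤ (xs ++ ys) e) (∈-++⁺ʳ xs z∈ys))

rightToLeftMaxima-∷-max : ∀ {c} xs → All (_< c) xs → rightToLeftMaxima (c ∷ xs) ≡ c ∷ rightToLeftMaxima xs
rightToLeftMaxima-∷-max xs xs<c with maxL xs in e
... | nothing = refl
... | just m  = if-cong (<ᵇ-true (All.lookup xs<c (maxL-∈ xs e)))

isMaxChain-rightToLeftMaxima : ∀ {L ps} → IsMaxChain L ps → map proj₂ ps ≡ rightToLeftMaxima L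
isMaxChain-rightToLeftMaxima []                                  = refl
isMaxChain-rightToLeftMaxima (cons {b} {c} {L} {ps} b<c L<c chain) = begin
  c ∷ map proj₂ ps                 ≡⟨ cong (c ∷_) (isMaxChain-rightToLeftMaxima chain) ⟩
  c ∷ rightToLeftMaxima L          ≡⟨ rightToLeftMaxima-∷-max L L<c ⟨
  rightToLeftMaxima (c ∷ L)        ≡⟨ rightToLeftMaxima-++-dominated b (c ∷ L) (All.map <⇒≤ b<c) (here refl) ⟨
  rightToLeftMaxima (b ++ c ∷ L)   ∎
  where open ≡-Reasoning

leftOf0-run-isMaxChain : ∀ {L ps} R st → IsMaxChain L ps → All (0 <_) L → All (_<Top st) (0 ∷ L) →
  leftOf0 (run (L ++ 0 ∷ R) st) ≡ concat (map (s ∘ proj₁) ps)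
leftOf0-run-isMaxChain R []       [] _ _          = leftOf0-run-0 R []
leftOf0-run-isMaxChain R (t ∷ st) [] _ (0<t ∷ _) =
  trans (cong leftOf0 (if-cong (<ᵇ-true 0<t))) (leftOf0-run-0 R (t ∷ st))
leftOf0-run-isMaxChain R st (cons {b} {c} {L} {ps} b<c L<c chain) bcL>0 (_ ∷ bcL<st) = begin
  leftOf0 (run ((b ++ c ∷ L) ++ 0 ∷ R) st)
    ≡⟨ cong (λ xs → leftOf0 (run xs st)) (++-assoc b (c ∷ L) (0 ∷ R)) ⟩
  leftOf0 (run (b ++ c ∷ L ++ 0 ∷ R) st)      ≡⟨ cong leftOf0 (run-flush c (L ++ 0 ∷ R) b [] st b<c [] c<st) ⟩
  leftOf0 (s b ++ run (L ++ 0 ∷ R) (c ∷ st))  ≡⟨ leftOf0-++ (s b) _ (↭.All-resp-↭ (↭-sym (s-↭ b)) b>0) ⟩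
  s b ++ leftOf0 (run (L ++ 0 ∷ R) (c ∷ st))
    ≡⟨ cong (s b ++_) (leftOf0-run-isMaxChain R (c ∷ st) chain L>0 (c>0 ∷ L<c)) ⟩
  s b ++ concat (map (s ∘ proj₁) ps)          ∎
  where
  open ≡-Reasoning
  b>0 : All (0 <_) b
  b>0 = Allₚ.++⁻ˡ b bcL>0
  c>0 : 0 < c
  c>0 = All.head (Allₚ.++⁻ʳ b bcL>0)
  L>0 : All (0 <_) L
  L>0 = All.tail (Allₚ.++⁻ʳ b bcL>0)
  c<st : c <Top st
  c<st = All.lookup bcL<st (∈-++⁺ʳ b (here refl))

s-ends-with-max : ∀ b {m} → Unique b → maxL b ≡ just m →
  ∃ λ front → s b ≡ front ++ [ m ] × All (_≤ m) front
s-ends-with-max b {m} ub e = front , s-b≡ , Allₚ.++⁻ˡ front (subst (All (_≤ m)) s-b≡ s-b≤m)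
  where
  b₁ = proj₁ (splitAt= m b)
  b₂ = proj₂ (splitAt= m b)
  split : b ≡ b₁ ++ m ∷ b₂ × All (_< m) b₁ × All (_< m) b₂
  split = splitAt-max b ub e
  front = s b₁ ++ s b₂
  s-b≡ : s b ≡ front ++ [ m ]
  s-b≡ = begin
    s b                          ≡⟨ cong s (proj₁ split) ⟩
    run (b₁ ++ m ∷ b₂) []        ≡⟨ run-flush m b₂ b₁ [] [] (proj₁ (proj₂ split)) [] tt ⟩
    s b₁ ++ run b₂ [ m ]         ≡⟨ cong (s b₁ ++_) (run-bottom b₂ [] [ m ] (proj₂ (proj₂ split)) []) ⟩
    s b₁ ++ (s b₂ ++ [ m ])      ≡⟨ ++-assoc (s b₁) (s b₂) [ m ] ⟨
    front ++ [ m ]               ∎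
    where open ≡-Reasoning
  s-b≤m : All (_≤ m) (s b)
  s-b≤m = ↭.All-resp-↭ (↭-sym (s-↭ b)) (maxL-≤ b e)

IsBlockMax : ℕ → List ℕ × ℕ → Set
IsBlockMax x (b , _) = maxL b ≡ just x

rightToLeftMaxima-concat-s : ∀ ps → All (Unique ∘ proj₁) ps →
  Sublist IsBlockMax (rightToLeftMaxima (concat (map (s ∘ proj₁) ps))) ps
rightToLeftMaxima-concat-s []             []          = []
rightToLeftMaxima-concat-s ((b , c) ∷ ps) (ub ∷ ubs) with maxL b in e
... | nothing rewrite maxL-nothing b e = ([] , c) ∷ʳ rightToLeftMaxima-concat-s ps ubs
... | just m  with s-ends-with-max b ub e
... | front , s-b≡ , front≤m = subst (λ xs → Sublist IsBlockMax xs ((b , c) ∷ ps)) (sym rlm≡)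
                           (∷-rightToLeftMaxima (rightToLeftMaxima-concat-s ps ubs))
  where
  Z = concat (map (s ∘ proj₁) ps)
  rlm≡ : rightToLeftMaxima (s b ++ Z) ≡ rightToLeftMaxima (m ∷ Z)
  rlm≡ = begin
    rightToLeftMaxima (s b ++ Z)              ≡⟨ cong (λ xs → rightToLeftMaxima (xs ++ Z)) s-b≡ ⟩
    rightToLeftMaxima ((front ++ [ m ]) ++ Z) ≡⟨ cong rightToLeftMaxima (++-assoc front [ m ] Z) ⟩
    rightToLeftMaxima (front ++ m ∷ Z)
      ≡⟨ rightToLeftMaxima-++-dominated front (m ∷ Z) front≤m (here refl) ⟩
    rightToLeftMaxima (m ∷ Z)                 ∎
    where open ≡-Reasoning
  ∷-rightToLeftMaxima : Sublist IsBlockMax (rightToLeftMaxima Z) ps →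
                        Sublist IsBlockMax (rightToLeftMaxima (m ∷ Z)) ((b , c) ∷ ps)
  ∷-rightToLeftMaxima r with maxL Z
  ... | nothing = e ∷ r
  ... | just m′ = if-elim (λ xs → Sublist IsBlockMax xs ((b , c) ∷ ps)) (m′ <ᵇ m) (e ∷ r) ((b , c) ∷ʳ r)

-- leftof π x = leftofIn (CB π i) x whenever col π x = suc i.
leftofIn : List (List ℕ × ℕ) → ℕ → Maybe ℕ
leftofIn ps x = blockWithMax x ps >>= λ j → nth j (map proj₂ ps)

just-suc-positive : ∀ {k j} → just (suc k) ≡ just j → 0 < j
just-suc-positive refl = z<s

blockWithMax-positive : ∀ x ps {j} → blockWithMax x ps ≡ just j → 0 < j
blockWithMax-positive x ((b , c) ∷ ps) e with maxL b
... | nothing with blockWithMax x ps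
...   | just _ = just-suc-positive e
blockWithMax-positive x ((b , c) ∷ ps) e | just m with m ≡ᵇ x
... | true = just-suc-positive e
... | false with blockWithMax x ps
...   | just _ = just-suc-positive e

nth-∷-shift : ∀ (c : ℕ) cs mj → (∀ {j} → mj ≡ just j → 0 < j) →
  ((mj >>= λ k → just (suc k)) >>= λ j → nth j (c ∷ cs)) ≡ (mj >>= λ j → nth j cs)
nth-∷-shift c cs nothing        _        = refl
nth-∷-shift c cs (just zero)    positive = contradiction (positive refl) λ ()
nth-∷-shift c cs (just (suc j)) _        = refl

leftofIn-keep : ∀ {x} b c ps → maxL b ≡ just x → leftofIn ((b , c) ∷ ps) x ≡ just c
leftofIn-keep {x} b c ps e rewrite e | ≡ᵇ-refl x = refl

leftofIn-skip : ∀ {x} b c ps → x ∉ b → leftofIn ((b , c) ∷ ps) x ≡ leftofIn ps x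
leftofIn-skip {x} b c ps x∉b with maxL b in e
... | nothing = nth-∷-shift c (map proj₂ ps) (blockWithMax x ps) (blockWithMax-positive x ps)
... | just m rewrite ≡ᵇ-false (λ m≡x → x∉b (maxL-∈ b (trans e (cong just m≡x)))) =
  nth-∷-shift c (map proj₂ ps) (blockWithMax x ps) (blockWithMax-positive x ps)

isBlockMax-∈-blocks : ∀ {xs ps x} → Sublist IsBlockMax xs ps → x ∈ xs → x ∈ blocks ps
isBlockMax-∈-blocks ((b , _) ∷ʳ r)               x∈xs         = ∈-++⁺ʳ b (isBlockMax-∈-blocks r x∈xs)
isBlockMax-∈-blocks (_∷_ {y = b , _} max-b r) (here refl) = ∈-++⁺ˡ (maxL-∈ b max-b)
isBlockMax-∈-blocks (_∷_ {y = b , _} _     r) (there x∈xs) = ∈-++⁺ʳ b (isBlockMax-∈-blocks r x∈xs)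

map-leftofIn-∷ : ∀ b c ps {xs} → Sublist IsBlockMax xs ps → Unique (b ++ blocks ps) →
                 map (leftofIn ((b , c) ∷ ps)) xs ≡ map (leftofIn ps) xs
map-leftofIn-∷ b c ps r ub = map-cong-local $ All.tabulate λ x∈xs →
  leftofIn-skip b c ps λ x∈b → Unique-++-disjoint b ub x∈b (isBlockMax-∈-blocks r x∈xs)

leftofIn-⊆ : ∀ {xs ps} → Sublist IsBlockMax xs ps → Unique (blocks ps) →
             map (leftofIn ps) xs ⊆ map (just ∘ proj₂) ps
leftofIn-⊆ []                                        _  = []
leftofIn-⊆ (_∷ʳ_ {ys = ps} (b , c) r)                ub =
  just c ∷ʳ subst (_⊆ _) (sym (map-leftofIn-∷ b c ps r ub)) (leftofIn-⊆ r (Unique-++-tail b ub))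
leftofIn-⊆ (_∷_ {y = b , c} {ys = ps} max-b r)       ub =
  leftofIn-keep b c ps max-b ∷ subst (_⊆ _) (sym (map-leftofIn-∷ b c ps r ub)) (leftofIn-⊆ r (Unique-++-tail b ub))

-- CB π (suc k) = blocksOf (iter k π).
blocksOf : List ℕ → List (List ℕ × ℕ)
blocksOf σ = chainBlocks (length σ) (leftOf0 σ)

blocksOf-isMaxChain : ∀ {σ} → Unique σ → 0 ∈ σ → IsMaxChain (leftOf0 σ) (blocksOf σ)
blocksOf-isMaxChain {σ} uσ 0∈σ = chainBlocks-isMaxChain (length σ) (leftOf0 σ)
  (⊆.length-mono-≤ (leftOf0-⊆ 0∈σ)) (Unique-resp-⊆ (leftOf0-⊆ 0∈σ) uσ)

module StackSortStep {σ : List ℕ} (uσ : Unique σ) (0∈σ : 0 ∈ σ) where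

  L  = leftOf0 σ
  ps = blocksOf σ
  cs = map proj₂ ps
  L′ = leftOf0 (s σ)

  private
    chain : IsMaxChain L ps
    chain = blocksOf-isMaxChain uσ 0∈σ

    L↭ : L ↭ blocks ps ++ cs
    L↭ = isMaxChain-↭ chain

    L′≡ : L′ ≡ concat (map (s ∘ proj₁) ps)
    L′≡ = trans (cong (leftOf0 ∘ s) (leftOf0-≡ 0∈σ))
                (leftOf0-run-isMaxChain _ [] chain (leftOf0-positive σ) (All.universal (λ _ → tt) (0 ∷ L)))

    L′↭ : L′ ↭ blocks ps
    L′↭ = subst (_↭ blocks ps) (trans (cong concat (sym (map-∘ ps))) (sym L′≡))
                (concat-map-s-↭ (map proj₁ ps))

    u-blocks++cs : Unique (blocks ps ++ cs)
    u-blocks++cs = Unique-resp-↭ L↭ (Unique-resp-⊆ (leftOf0-⊆ 0∈σ) uσ)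

  chain-⊆-leftOf0 : ∀ {x} → x ∈ cs → x ∈ L
  chain-⊆-leftOf0 x∈cs = ↭.∈-resp-↭ (↭-sym L↭) (∈-++⁺ʳ (blocks ps) x∈cs)

  leftOf0-s-⊆ : ∀ {x} → x ∈ L′ → x ∈ L
  leftOf0-s-⊆ x∈L′ = ↭.∈-resp-↭ (↭-sym L↭) (∈-++⁺ˡ (↭.∈-resp-↭ L′↭ x∈L′))

  chain-∉-leftOf0-s : ∀ {x} → x ∈ cs → x ∉ L′
  chain-∉-leftOf0-s x∈cs x∈L′ =
    Unique-++-disjoint (blocks ps) u-blocks++cs (↭.∈-resp-↭ L′↭ x∈L′) x∈cs

  leftOf0-s-shorter : 0 < length L′ → length L′ < length L
  leftOf0-s-shorter 0<|L′| = begin-strict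
    length L′                        <⟨ m<m+n (length L′) 0<|cs| ⟩
    length L′ + length cs            ≡⟨ cong (_+ length cs) (↭.↭-length L′↭) ⟩
    length (blocks ps) + length cs   ≡⟨ length-++ (blocks ps) ⟨
    length (blocks ps ++ cs)         ≡⟨ ↭.↭-length L↭ ⟨
    length L                         ∎
    where
    open ≤-Reasoning
    nonempty : ∀ qs → 0 < length (concat (map (s ∘ proj₁) qs)) → 0 < length (map proj₂ qs)
    nonempty (_ ∷ _) _ = z<s
    0<|cs| : 0 < length cs
    0<|cs| = nonempty ps (subst (λ xs → 0 < length xs) L′≡ 0<|L′|)

  Unique-chain : Unique cs
  Unique-chain = Unique-++-tail (blocks ps) u-blocks++cs

  Unique-blocks : Unique (blocks ps)
  Unique-blocks = Unique-resp-⊆ (⊆.++⁺ʳ cs ⊆-refl) u-blocks++cs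

  chain-s-isBlockMax : Sublist IsBlockMax (map proj₂ (blocksOf (s σ))) ps
  chain-s-isBlockMax = subst (λ xs → Sublist IsBlockMax xs ps) (sym chain-s≡)
    (rightToLeftMaxima-concat-s ps (Allₚ.map⁻ (Unique-concat⁻ (map proj₁ ps) Unique-blocks)))
    where
    chain-s≡ : map proj₂ (blocksOf (s σ)) ≡ rightToLeftMaxima (concat (map (s ∘ proj₁) ps))
    chain-s≡ = trans (isMaxChain-rightToLeftMaxima (blocksOf-isMaxChain u-sσ 0∈sσ)) (cong rightToLeftMaxima L′≡)
      where
      u-sσ : Unique (s σ)
      u-sσ = Unique-resp-↭ (↭-sym (s-↭ σ)) uσ
      0∈sσ : 0 ∈ s σ
      0∈sσ = ↭.∈-resp-↭ (↭-sym (s-↭ σ)) 0∈σ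

indexOf-∈ : ∀ {x} l → x ∈ l → ∃ λ j → indexOf x l ≡ just j
indexOf-∈ {x} (y ∷ l) x∈ with y ≡ᵇ x in e
... | true = 1 , refl
indexOf-∈ (y ∷ l) (here refl)  | false = ⊥-elim (subst T e (≡⇒≡ᵇ y y refl))
indexOf-∈ (y ∷ l) (there x∈l) | false with indexOf-∈ l x∈l
... | j , e′ rewrite e′ = suc j , refl

indexOf-∉ : ∀ {x} l → x ∉ l → indexOf x l ≡ nothing
indexOf-∉ []      _   = refl
indexOf-∉ {x} (y ∷ l) x∉
  rewrite ≡ᵇ-false {y} {x} (λ y≡x → x∉ (here (sym y≡x))) | indexOf-∉ l (x∉ ∘ there) = refl

indexOf-self : ∀ l → Unique l → map (λ x → indexOf x l) l ≡ map just (applyUpTo suc (length l))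
indexOf-self []      _            = refl
indexOf-self (y ∷ l) (y≢l ∷ u) rewrite ≡ᵇ-refl y = cong (just 1 ∷_) $ begin
  map (λ x → indexOf x (y ∷ l)) l                   ≡⟨ map-cong-local (All.map (if-cong ∘ ≡ᵇ-false) y≢l) ⟩
  map (λ x → indexOf x l >>= just ∘ suc) l           ≡⟨ map-∘ l ⟩
  map (_>>= just ∘ suc) (map (λ x → indexOf x l) l)  ≡⟨ cong (map (_>>= just ∘ suc)) (indexOf-self l u) ⟩
  map (_>>= just ∘ suc) (map just 1…n)               ≡⟨ map-∘ 1…n ⟨
  map (just ∘ suc) 1…n                               ≡⟨ map-∘ 1…n ⟩
  map just (map suc 1…n)                             ≡⟨ cong (map just) (map-applyUpTo suc suc (length l)) ⟩
  map just (applyUpTo (suc ∘ suc) (length l))        ∎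
  where
  open ≡-Reasoning
  1…n = applyUpTo suc (length l)

colSearch-≡ : ∀ π x f start d → d < f → x ∈ C π (start + d) → (∀ e → e < d → x ∉ C π (start + e)) →
              colSearch π x start f ≡ just (start + d)
colSearch-≡ π x (suc f) start zero    _         x∈ _
  rewrite +-identityʳ start | proj₂ (indexOf-∈ (C π start) x∈) = refl
colSearch-≡ π x (suc f) start (suc d) (s<s d<f) x∈ earlier
  rewrite indexOf-∉ (C π start) (subst (λ i → x ∉ C π i) (+-identityʳ start) (earlier zero z<s)) = begin
    colSearch π x (suc start) f   ≡⟨ colSearch-≡ π x f (suc start) d d<f x∈C earlier′ ⟩
    just (suc start + d)          ≡⟨ cong just (+-suc start d) ⟨
    just (start + suc d)          ∎
  where
  open ≡-Reasoning
  x∈C : x ∈ C π (suc start + d)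
  x∈C = subst (λ i → x ∈ C π i) (+-suc start d) x∈
  earlier′ : ∀ e → e < d → x ∉ C π (suc start + e)
  earlier′ e e<d = subst (λ i → x ∉ C π i) (+-suc start e) (earlier (suc e) (s<s e<d))

module Columns {π : List ℕ} (uπ : Unique π) (0∈π : 0 ∈ π) where

  ℓ : ℕ → ℕ
  ℓ k = length (leftOf0 (iter k π))

  private
    module Step k = StackSortStep (Unique-resp-↭ (↭-sym (iter-↭ k π)) uπ)
                                  (↭.∈-resp-↭ (↭-sym (iter-↭ k π)) 0∈π)

    leftOf0-iter-suc : ∀ k → leftOf0 (iter (suc k) π) ≡ leftOf0 (s (iter k π))
    leftOf0-iter-suc k = cong leftOf0 (iter-suc k π)

  C-⊆-leftOf0 : ∀ k {x} → x ∈ C π (suc k) → x ∈ leftOf0 (iter k π)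
  C-⊆-leftOf0 k = Step.chain-⊆-leftOf0 k

  C-∉-leftOf0-suc : ∀ k {x} → x ∈ C π (suc k) → x ∉ leftOf0 (iter (suc k) π)
  C-∉-leftOf0-suc k x∈C = Step.chain-∉-leftOf0-s k x∈C ∘ subst (_ ∈_) (leftOf0-iter-suc k)

  leftOf0-iter-⊆ : ∀ d j {x} → x ∈ leftOf0 (iter (d + j) π) → x ∈ leftOf0 (iter j π)
  leftOf0-iter-⊆ zero    j x∈ = x∈
  leftOf0-iter-⊆ (suc d) j x∈ =
    leftOf0-iter-⊆ d j (Step.leftOf0-s-⊆ (d + j) (subst (_ ∈_) (leftOf0-iter-suc (d + j)) x∈))

  C-disjoint : ∀ {j k x} → j < k → x ∈ C π (suc k) → x ∉ C π (suc j)
  C-disjoint {j} {k} j<k x∈Cₖ x∈Cⱼ = C-∉-leftOf0-suc j x∈Cⱼ (leftOf0-iter-⊆ (k ∸ suc j) (suc j)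
    (subst (λ i → _ ∈ leftOf0 (iter i π)) (sym (m∸n+n≡m j<k)) (C-⊆-leftOf0 k x∈Cₖ)))

  ℓ-bound : ∀ k → 0 < ℓ k → k + ℓ k ≤ ℓ 0
  ℓ-bound zero    _ = ≤-refl
  ℓ-bound (suc k) 0<ℓ = begin
    suc k + ℓ (suc k)   ≡⟨ +-suc k (ℓ (suc k)) ⟨
    k + suc (ℓ (suc k)) ≤⟨ +-monoʳ-≤ k ℓ-suc<ℓ ⟩
    k + ℓ k             ≤⟨ ℓ-bound k (<-≤-trans 0<ℓ (<⇒≤ ℓ-suc<ℓ)) ⟩
    ℓ 0                 ∎
    where
    open ≤-Reasoning
    ℓ-suc<ℓ : ℓ (suc k) < ℓ k
    ℓ-suc<ℓ = subst (λ L → length L < ℓ k) (sym (leftOf0-iter-suc k))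
                (Step.leftOf0-s-shorter k (subst (λ L → 0 < length L) (leftOf0-iter-suc k) 0<ℓ))

  C-bound : ∀ k {x} → x ∈ C π (suc k) → suc k < length π
  C-bound k x∈C = begin-strict
    suc k        ≡⟨ +-comm 1 k ⟩
    k + 1        ≤⟨ +-monoʳ-≤ k 0<ℓ ⟩
    k + ℓ k      ≤⟨ ℓ-bound k 0<ℓ ⟩
    ℓ 0          <⟨ leftOf0-shorter 0∈π ⟩
    length π     ∎
    where
    open ≤-Reasoning
    0<ℓ : 0 < ℓ k
    0<ℓ with leftOf0 (iter k π) | C-⊆-leftOf0 k x∈C
    ... | _ ∷ _ | _ = z<s

  col-C : ∀ k {x} → x ∈ C π (suc k) → col π x ≡ just (suc k)
  col-C k x∈C =
    colSearch-≡ π _ (length π) 1 k (<-trans (n<1+n k) (C-bound k x∈C)) x∈C (λ e e<k → C-disjoint e<k x∈C)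

  rows-C₁ : ∀ f → StrictlyIncreasingDefined (map (rowF π (suc f)) (C π 1))
  rows-C₁ f = applyUpTo suc (length (C π 1)) , rows≡ ,
              AllPairs⇒Linked (AllPairsₚ.applyUpTo⁺₁ suc _ λ i<j _ → s<s i<j)
    where
    row≡indexOf : ∀ {x} → x ∈ C π 1 → rowF π (suc f) x ≡ indexOf x (C π 1)
    row≡indexOf x∈C rewrite col-C 0 x∈C = refl
    rows≡ : map (rowF π (suc f)) (C π 1) ≡ map just (applyUpTo suc (length (C π 1)))
    rows≡ = trans (map-cong-local (All.tabulate row≡indexOf)) (indexOf-self (C π 1) (Step.Unique-chain 0))

  rows-C-suc-⊆ : ∀ k f → map (rowF π (suc f)) (C π (suc (suc k))) ⊆ map (rowF π f) (C π (suc k))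
  rows-C-suc-⊆ k f = subst₂ _⊆_ (sym rows≡) (trans (sym (map-∘ ps)) (map-∘ ps))
    (⊆.map⁺ (_>>= rowF π f) (leftofIn-⊆ C-suc-isBlockMax (Step.Unique-blocks k)))
    where
    ps = CB π (suc k)
    C-suc-isBlockMax : Sublist IsBlockMax (C π (suc (suc k))) ps
    C-suc-isBlockMax = subst (λ σ → Sublist IsBlockMax (map proj₂ (blocksOf σ)) ps) (sym (iter-suc k π))
                         (Step.chain-s-isBlockMax k)
    row≡leftof : ∀ {x} → x ∈ C π (suc (suc k)) → rowF π (suc f) x ≡ (leftofIn ps x >>= rowF π f)
    row≡leftof x∈C rewrite col-C (suc k) x∈C = refl
    rows≡ : map (rowF π (suc f)) (C π (suc (suc k))) ≡ map (_>>= rowF π f) (map (leftofIn ps) (C π (suc (suc k))))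
    rows≡ = trans (map-cong-local (All.tabulate row≡leftof)) (map-∘ _)

  rows-increasing : ∀ k f → suc k ≤ f → StrictlyIncreasingDefined (map (rowF π f) (C π (suc k)))
  rows-increasing zero    (suc f) _         = rows-C₁ f
  rows-increasing (suc k) (suc f) (s≤s k<f) =
    StrictlyIncreasingDefined-resp-⊆ (rows-C-suc-⊆ k f) (rows-increasing k f k<f)

  -- row π runs rowF π with fuel length π, which suffices for every nonempty column.
  row-increasing : ∀ k → StrictlyIncreasingDefined (map (row π) (C π (suc k)))
  row-increasing k = via-bound (C π (suc k)) (C-bound k) (rows-increasing k (length π) ∘ <⇒≤)
    where
    via-bound : ∀ cs → (∀ {x} → x ∈ cs → suc k < length π) →
                (suc k < length π → StrictlyIncreasingDefined (map (row π) cs)) →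
                StrictlyIncreasingDefined (map (row π) cs)
    via-bound []      _     _      = [] , refl , []
    via-bound (_ ∷ _) bound proves = proves (bound (here refl))

-- Only that π has distinct entries and contains 0 is used.
lemma3p15 : (n : ℕ) (π : List ℕ) → π ↭ upTo (suc n) → Σ (List ℕ) (λ ρ → π ≡ ρ ++ [ 0 ]) →
    (k : ℕ) → IsSc π k → (i : ℕ) → 1 ≤ i → i ≤ k →
    StrictlyIncreasingDefined (map (row π) (C π i))
lemma3p15 n π π↭ (ρ , π≡) _ _ (suc i) _ _ = Columns.row-increasing uπ 0∈π i
  where
  uπ : Unique π
  uπ = Unique-resp-↭ (↭-sym π↭) (upTo⁺ (suc n))
  0∈π : 0 ∈ π
  0∈π = subst (0 ∈_) (sym π≡) (∈-++⁺ʳ ρ (here refl))
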